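{- Let $T$ be a $7$-tournament with vertices $v_1,\dots,v_7$ such that $T[v_1,\dots,v_6]$ is isomorphic to $L_6$. Then $T\in\mathcal{D}_5\setminus\mathcal{D}_3$ if and only if there exists $i\in\{1,\dots,6\}$ such that $v_7$ and $v_i$ are covertices or revertices in $T$.
   Context: A tournament is a directed graph with exactly one arc between each pair of distinct vertices; $u\rightarrow v$ means the arc goes from $u$ to $v$. $T[X]$ denotes the subtournament induced by $X$. For a tournament $T$ on vertices $v_1,\dots,v_n$, its skew-adjacency matrix is the zero-diagonal matrix $S_T=[s_{ij}]$ with $s_{ij}=-s_{ji}=1$ if $v_i\rightarrow v_j$, and $\det(T):=\det(S_T)$. A subtournament is induced by a nonempty vertex subset (including $T$ itself). For a positive odd integer $k$, $\mathcal{D}_k$ is the set of tournaments all of whose subtournaments have determinant at most $k^2$. $L_6$ is the tournament on $u_1,\dots,u_6$ with $u_i\rightarrow u_j$ for $1\le i<j\le 5$, $u_6\rightarrow u_1,u_3,u_5$ and $u_2,u_4\rightarrow u_6$. Distinct vertices $a,b$ of $T$ are covertices if for every $v\in V(T)\setminus\{a,b\}$, $a\rightarrow v$ iff $b\rightarrow v$; they are revertices if for every $v\in V(T)\setminus\{a,b\}$, $a\rightarrow v$ iff $v\rightarrow b$. -}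

module Defs where

open import Data.Nat using (ℕ; zero; suc; _*_; _≤_)
open import Data.Integer as ℤ using (ℤ; +_; -_; 0ℤ; 1ℤ)
open import Data.Fin using (Fin; zero; suc; toℕ; punchIn; inject₁; fromℕ)
open import Data.Bool using (Bool; true; false; if_then_else_; not; _∧_; _∨_)
open import Data.Nat using (_<ᵇ_; _≡ᵇ_)
open import Data.Product using (Σ; _×_; ∃-syntax)
open import Data.Sum using (_⊎_)
open import Relation.Binary.PropositionalEquality using (_≡_; _≢_)
open import Relation.Nullary using (¬_)
open import Function.Definitions using (Injective)

record Tournament (n : ℕ) : Set where
  field
    arc     : Fin n → Fin n → Bool
    irrefl  : ∀ i → arc i i ≡ false
    oneArc  : ∀ i j → i ≢ j → arc j i ≡ not (arc i j)
open Tournament public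

skew : ∀ {n} → Tournament n → Fin n → Fin n → ℤ
skew T i j = if arc T i j then 1ℤ else (if arc T j i then - 1ℤ else 0ℤ)

sumFin : ∀ n → (Fin n → ℤ) → ℤ
sumFin zero    f = 0ℤ
sumFin (suc n) f = f zero ℤ.+ sumFin n (λ i → f (suc i))

sign : ℕ → ℤ
sign zero          = 1ℤ
sign (suc zero)    = - 1ℤ
sign (suc (suc k)) = sign k

det : ∀ n → (Fin n → Fin n → ℤ) → ℤ
det zero    M = 1ℤ
det (suc n) M =
  sumFin (suc n) (λ j → sign (toℕ j) ℤ.* (M zero j ℤ.* det n (λ a b → M (suc a) (punchIn j b))))

-- det(T[X]) for the subtournament induced by the image of an injection f : Fin m → Fin n
-- (the vertices of X listed in the order given by f; the determinant does not
-- depend on the ordering since reordering is a simultaneous row/column permutation).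
detSub : ∀ {n m} → Tournament n → (Fin m → Fin n) → ℤ
detSub {m = m} T f = det m (λ a b → skew T (f a) (f b))

InD : ℕ → ∀ {n} → Tournament n → Set
InD k {n} T = ∀ m (f : Fin m → Fin n) → Injective _≡_ _≡_ f → 1 ≤ m →
              detSub T f ℤ.≤ + (k * k)

L6arc : Fin 6 → Fin 6 → Bool
L6arc i j =
  if toℕ i ≡ᵇ 5 then ((toℕ j ≡ᵇ 0) ∨ (toℕ j ≡ᵇ 2) ∨ (toℕ j ≡ᵇ 4))
  else if toℕ j ≡ᵇ 5 then ((toℕ i ≡ᵇ 1) ∨ (toℕ i ≡ᵇ 3))
  else (toℕ i <ᵇ toℕ j)

-- T[v₁,…,v₆] ≅ L₆ for a 7-tournament (v_i = index i-1, v₇ = index 6).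
FirstSixIsoL6 : Tournament 7 → Set
FirstSixIsoL6 T = Σ (Fin 6 → Fin 6) λ σ → Injective _≡_ _≡_ σ ×
  (∀ i j → arc T (inject₁ (σ i)) (inject₁ (σ j)) ≡ L6arc i j)

Covertices : ∀ {n} → Tournament n → Fin n → Fin n → Set
Covertices T a b = a ≢ b × (∀ v → v ≢ a → v ≢ b → arc T a v ≡ arc T b v)

Revertices : ∀ {n} → Tournament n → Fin n → Fin n → Set
Revertices T a b = a ≢ b × (∀ v → v ≢ a → v ≢ b → arc T a v ≡ arc T v b)

module Submission where

-- Relabel T so that v₁,…,v₆ carry L₆ and v₇ becomes a new vertex 0: T is then L₆ extended by a
-- vertex whose out-neighbourhood is some N ⊆ {u₁,…,u₆}. T ∉ 𝒟₃ because det L₆ = 25 > 9. For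
-- each of the 64 sets N a computation shows that either the new vertex has a covertex or
-- revertex uᵢ and all principal minors are at most 25, or it has none and deleting a suitable
-- vertex leaves a 6-subtournament of determinant greater than 25. Determinants of
-- subtournaments are computed as minors indexed by lists of vertices; these are invariant under
-- simultaneous permutations of rows and columns, so det T[X] depends only on the set X, and the
-- minors indexed by subsets decide membership in 𝒟₅.

open import Defs
open import Data.Nat as ℕ using (ℕ; zero; suc; s≤s; z≤n)
import Data.Nat.Properties as ℕ
open import Data.Integer as ℤ using (ℤ; +_; +[1+_]; -[1+_]; -_; 0ℤ; 1ℤ; _+_; _-_; _*_)
import Data.Integer.Properties as ℤ
open import Data.Integer.Tactic.RingSolver using (solve-∀)
open import Data.Bool using (Bool; true; false; not; T)
open import Data.Bool.Properties as Bool using (not-involutive)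
open import Data.Empty using (⊥-elim)
open import Data.Fin using (Fin; zero; suc; toℕ; fromℕ; inject₁; punchIn; punchOut)
open import Data.Fin.Properties using (_≟_; all?; any?; injective⇒≤; punchOut-injective; punchIn-injective;
  inject₁-injective; fromℕ≢inject₁)
open import Data.Fin.Patterns using (0F; 1F; 2F; 3F; 4F; 5F)
open import Data.Fin.Subset using (Subset)
open import Data.Fin.Subset.Properties using (anySubset?)
open import Data.List using (List; []; _∷_; tabulate; filter; allFin)
open import Data.List.Membership.Propositional using (_∈_)
open import Data.List.Membership.Propositional.Properties using (∈-filter⁺; ∈-filter⁻; ∈-allFin)
open import Data.List.Membership.Propositional.Properties.WithK using (unique∧set⇒bag)
open import Data.List.Relation.Binary.BagAndSetEquality using (∼bag⇒↭)
open import Data.List.Relation.Binary.Permutation.Propositional as ↭ using (_↭_)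
import Data.List.Relation.Unary.Any as Any
import Data.List.Relation.Unary.Unique.Propositional.Properties as Unique
open import Data.Vec as Vec using (lookup)
open import Data.Vec.Properties using (lookup∘tabulate)
open import Data.Product using (_×_; _,_; proj₁; proj₂; ∃; ∃-syntax)
open import Data.Sum using (_⊎_; inj₁; inj₂) renaming (map to ⊎-map)
open import Function using (_∘_; const)
open import Function.Bundles using (_⇔_; mk⇔; Equivalence)
open import Function.Definitions using (Injective)
open import Relation.Binary.Construct.Closure.ReflexiveTransitive using (Star; ε; _◅_; _◅◅_; gmap)
open import Relation.Binary.PropositionalEquality
open import Relation.Nullary using (¬_; Dec; yes; no; ¬?; _×-dec_; _⊎-dec_; _→-dec_)
open import Relation.Nullary.Decidable using (map′; decidable-stable; toWitness; fromWitness; T?; ⌊_⌋)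
open import Relation.Unary using (Pred; Decidable)

-- Minors by Laplace expansion

infixl 7 _⊛_

-- a ⊛ b = a * b, but b is not evaluated when a = 0; this roughly halves the cost of the
-- exhaustive computations of minors below.
_⊛_ : ℤ → ℤ → ℤ
(+ 0) ⊛ _ = 0ℤ
a     ⊛ b = a * b

⊛≡* : ∀ a b → a ⊛ b ≡ a * b
⊛≡* (+ zero)  b = refl
⊛≡* +[1+ n ]  b = refl
⊛≡* -[1+ n ]  b = refl

neg-sub-neg : ∀ a b → - a - - b ≡ - (a - b)
neg-sub-neg = solve-∀

sub-sub-neg : ∀ a b c → a - (b - - c) ≡ - (b - (a - c))
sub-sub-neg = solve-∀

sub-sub-sub : ∀ a b c d → (a - b) - (c - d) ≡ (a - c) - (b - d)
sub-sub-sub = solve-∀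

*-distribˡ-sub : ∀ k a b → k * (a - b) ≡ k * a - k * b
*-distribˡ-sub = solve-∀

*-left-comm : ∀ a b c → a * (b * c) ≡ b * (a * c)
*-left-comm = solve-∀

⊛-neg : ∀ a b → a ⊛ (- b) ≡ - (a ⊛ b)
⊛-neg a b = begin
  a ⊛ - b   ≡⟨ ⊛≡* a (- b) ⟩
  a * - b   ≡⟨ ℤ.neg-distribʳ-* a b ⟨
  - (a * b) ≡⟨ cong -_ (⊛≡* a b) ⟨
  - (a ⊛ b) ∎
  where open ≡-Reasoning

sumFin-cong : ∀ n {f g : Fin n → ℤ} → (∀ i → f i ≡ g i) → sumFin n f ≡ sumFin n g
sumFin-cong zero    f≗g = refl
sumFin-cong (suc n) f≗g = cong₂ _+_ (f≗g zero) (sumFin-cong n (f≗g ∘ suc))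

sumFin-neg : ∀ n (f : Fin n → ℤ) → sumFin n (λ i → - f i) ≡ - sumFin n f
sumFin-neg zero    f = refl
sumFin-neg (suc n) f =
  trans (cong (λ t → - f zero + t) (sumFin-neg n (f ∘ suc))) (sym (ℤ.neg-distrib-+ (f zero) _))

sign-suc : ∀ k → sign (suc k) ≡ - sign k
sign-suc zero          = refl
sign-suc (suc zero)    = refl
sign-suc (suc (suc k)) = sign-suc k

det-cong : ∀ n {M M′ : Fin n → Fin n → ℤ} → (∀ a b → M a b ≡ M′ a b) → det n M ≡ det n M′
det-cong zero    M≗M′ = refl
det-cong (suc n) M≗M′ = sumFin-cong (suc n) λ j → cong (sign (toℕ j) *_)
  (cong₂ _*_ (M≗M′ zero j) (det-cong n (λ a b → M≗M′ (suc a) (punchIn j b))))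

module _ {A : Set} where

  -- expand F [c₀, …, cₖ] = Σⱼ (-1)ʲ F cⱼ [c₀, …, cₖ without cⱼ]
  expand : (A → List A → ℤ) → List A → ℤ
  expand F []       = 0ℤ
  expand F (c ∷ cs) = F c cs - expand (λ c′ cs′ → F c′ (c ∷ cs′)) cs

  -- The determinant of the submatrix of M on rows rs and columns cs, in this order
  -- (0 if the lengths differ).
  minor : (A → A → ℤ) → List A → List A → ℤ
  minor M []       []      = 1ℤ
  minor M []       (_ ∷ _) = 0ℤ
  minor M (r ∷ rs) cs      = expand (λ c cs′ → M r c ⊛ minor M rs cs′) cs

  expand-cong : ∀ {F G} → (∀ c cs → F c cs ≡ G c cs) → ∀ cs → expand F cs ≡ expand G cs
  expand-cong F≗G []       = refl
  expand-cong F≗G (c ∷ cs) = cong₂ _-_ (F≗G c cs) (expand-cong (λ c′ cs′ → F≗G c′ (c ∷ cs′)) cs)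

  expand-neg : ∀ F cs → expand (λ c cs′ → - F c cs′) cs ≡ - expand F cs
  expand-neg F []       = refl
  expand-neg F (c ∷ cs) = begin
    - F c cs - expand (λ c′ cs′ → - F c′ (c ∷ cs′)) cs ≡⟨ cong (λ t → - F c cs - t) (expand-neg _ cs) ⟩
    - F c cs - - expand (λ c′ cs′ → F c′ (c ∷ cs′)) cs ≡⟨ neg-sub-neg (F c cs) _ ⟩
    - expand F (c ∷ cs)                                 ∎
    where open ≡-Reasoning

  expand-sub : ∀ F G cs → expand (λ c cs′ → F c cs′ - G c cs′) cs ≡ expand F cs - expand G cs
  expand-sub F G []       = refl
  expand-sub F G (c ∷ cs) =
    trans (cong (λ t → F c cs - G c cs - t) (expand-sub _ _ cs)) (sub-sub-sub (F c cs) (G c cs) _ _)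

  *-expand : ∀ k F cs → k * expand F cs ≡ expand (λ c cs′ → k * F c cs′) cs
  *-expand k F []       = ℤ.*-zeroʳ k
  *-expand k F (c ∷ cs) = trans (*-distribˡ-sub k _ _) (cong (λ t → k * F c cs - t) (*-expand k _ cs))

  data Swap : List A → List A → Set where
    here  : ∀ x y xs → Swap (x ∷ y ∷ xs) (y ∷ x ∷ xs)
    there : ∀ z {xs ys} → Swap xs ys → Swap (z ∷ xs) (z ∷ ys)

  ↭⇒Swap⋆ : ∀ {xs ys} → xs ↭ ys → Star Swap xs ys
  ↭⇒Swap⋆ ↭.refl                = ε
  ↭⇒Swap⋆ (↭.prep x p)          = gmap (x ∷_) (there x) (↭⇒Swap⋆ p)
  ↭⇒Swap⋆ (↭.swap {xs} x y p)   =
    here x y xs ◅ gmap (y ∷_) (there y) (gmap (x ∷_) (there x) (↭⇒Swap⋆ p))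
  ↭⇒Swap⋆ (↭.trans p q)         = ↭⇒Swap⋆ p ◅◅ ↭⇒Swap⋆ q

  Alternating : (A → List A → ℤ) → Set
  Alternating F = ∀ c {cs cs′} → Swap cs cs′ → F c cs′ ≡ - F c cs

  expand-swap : ∀ F → Alternating F → ∀ {cs cs′} → Swap cs cs′ → expand F cs′ ≡ - expand F cs
  expand-swap F alt (here x y cs) = begin
    F y (x ∷ cs) - (F x (y ∷ cs) - expand (λ c cs′ → F c (y ∷ x ∷ cs′)) cs)
      ≡⟨ cong (λ t → F y (x ∷ cs) - (F x (y ∷ cs) - t)) swapped ⟩
    F y (x ∷ cs) - (F x (y ∷ cs) - - expand (λ c cs′ → F c (x ∷ y ∷ cs′)) cs)
      ≡⟨ sub-sub-neg (F y (x ∷ cs)) (F x (y ∷ cs)) _ ⟩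
    - expand F (x ∷ y ∷ cs) ∎
    where
    open ≡-Reasoning
    swapped = trans (expand-cong (λ c cs′ → alt c (here x y cs′)) cs) (expand-neg _ cs)
  expand-swap F alt (there z {cs} s) =
    trans (cong₂ _-_ (alt z s) (expand-swap _ (λ c s′ → alt c (there z s′)) s))
          (neg-sub-neg (F z cs) _)

  minor-swapᶜ : ∀ M rs {cs cs′} → Swap cs cs′ → minor M rs cs′ ≡ - minor M rs cs
  minor-swapᶜ M []       (here x y cs) = refl
  minor-swapᶜ M []       (there z s)   = refl
  minor-swapᶜ M (r ∷ rs) s             =
    expand-swap _ (λ c s′ → trans (cong (M r c ⊛_) (minor-swapᶜ M rs s′)) (⊛-neg (M r c) _)) s

  minor-∷ : ∀ M r rs cs → minor M (r ∷ rs) cs ≡ expand (λ c cs′ → M r c * minor M rs cs′) cs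
  minor-∷ M r rs = expand-cong (λ c cs′ → ⊛≡* (M r c) _)

  expand² : (A → A → List A → ℤ) → List A → ℤ
  expand² G = expand (λ c → expand (G c))

  minor-∷∷ : ∀ M r r′ rs cs →
             minor M (r ∷ r′ ∷ rs) cs ≡ expand² (λ c c′ cs′ → M r c * (M r′ c′ * minor M rs cs′)) cs
  minor-∷∷ M r r′ rs cs = trans (minor-∷ M r (r′ ∷ rs) cs) (expand-cong (λ c cs′ →
    trans (cong (M r c *_) (minor-∷ M r′ rs cs′)) (*-expand (M r c) _ cs′)) cs)

  expand²-flip : ∀ G cs → expand² (λ c c′ → G c′ c) cs ≡ - expand² G cs
  expand²-flip G []       = refl
  expand²-flip G (z ∷ cs) = begin
    Q - expand (λ c cs′ → G z c cs′ - expand (λ c′ cs″ → G c′ c (z ∷ cs″)) cs′) cs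
      ≡⟨ cong (λ t → Q - t) (expand-sub _ _ cs) ⟩
    Q - (P - expand² (λ c c′ cs′ → G c′ c (z ∷ cs′)) cs)
      ≡⟨ cong (λ t → Q - (P - t)) (expand²-flip (λ c c′ cs′ → G c c′ (z ∷ cs′)) cs) ⟩
    Q - (P - - R)
      ≡⟨ sub-sub-neg Q P R ⟩
    - (P - (Q - R))
      ≡⟨ cong (λ t → - (P - t)) (expand-sub _ _ cs) ⟨
    - expand² G (z ∷ cs) ∎
    where
    open ≡-Reasoning
    P = expand (G z) cs
    Q = expand (λ c cs′ → G c z cs′) cs
    R = expand² (λ c c′ cs′ → G c c′ (z ∷ cs′)) cs

  minor-swapʳ : ∀ M {rs rs′} → Swap rs rs′ → ∀ cs → minor M rs′ cs ≡ - minor M rs cs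
  minor-swapʳ M (there r s)   cs = trans
    (expand-cong (λ c cs′ → trans (cong (M r c ⊛_) (minor-swapʳ M s cs′)) (⊛-neg (M r c) _)) cs)
    (expand-neg _ cs)
  minor-swapʳ M (here x y rs) cs = begin
    minor M (y ∷ x ∷ rs) cs
      ≡⟨ minor-∷∷ M y x rs cs ⟩
    expand² (λ c c′ cs′ → M y c * (M x c′ * minor M rs cs′)) cs
      ≡⟨ expand-cong (λ c → expand-cong (λ c′ cs′ → *-left-comm (M y c) (M x c′) _)) cs ⟩
    expand² (λ c c′ cs′ → M x c′ * (M y c * minor M rs cs′)) cs
      ≡⟨ expand²-flip (λ c c′ cs′ → M x c * (M y c′ * minor M rs cs′)) cs ⟩
    - expand² (λ c c′ cs′ → M x c * (M y c′ * minor M rs cs′)) cs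
      ≡⟨ cong -_ (minor-∷∷ M x y rs cs) ⟨
    - minor M (x ∷ y ∷ rs) cs ∎
    where open ≡-Reasoning

  minor-swap : ∀ M {xs ys} → Swap xs ys → minor M xs xs ≡ minor M ys ys
  minor-swap M {xs} {ys} s = begin
    minor M xs xs     ≡⟨ ℤ.neg-involutive _ ⟨
    - - minor M xs xs ≡⟨ cong -_ (minor-swapᶜ M xs s) ⟨
    - minor M xs ys   ≡⟨ minor-swapʳ M s ys ⟨
    minor M ys ys     ∎
    where open ≡-Reasoning

  minor-↭ : ∀ M {xs ys} → xs ↭ ys → minor M xs xs ≡ minor M ys ys
  minor-↭ M = go ∘ ↭⇒Swap⋆
    where
    go : ∀ {xs ys} → Star Swap xs ys → minor M xs xs ≡ minor M ys ys
    go ε       = refl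
    go (s ◅ p) = trans (minor-swap M s) (go p)

  expand-tabulate : ∀ n F (h : Fin (suc n) → A) →
    expand F (tabulate h) ≡ sumFin (suc n) (λ j → sign (toℕ j) * F (h j) (tabulate (h ∘ punchIn j)))
  expand-tabulate zero    F h = cong (_+ 0ℤ) (sym (ℤ.*-identityˡ (F (h zero) [])))
  expand-tabulate (suc n) F h = begin
    a - expand (λ c cs → F c (h zero ∷ cs)) (tabulate (h ∘ suc))
      ≡⟨ cong (λ t → a - t) (expand-tabulate n (λ c cs → F c (h zero ∷ cs)) (h ∘ suc)) ⟩
    a - sumFin (suc n) (λ j → sign (toℕ j) * X j)
      ≡⟨ cong (λ t → a + t) (sumFin-neg (suc n) (λ j → sign (toℕ j) * X j)) ⟨
    a + sumFin (suc n) (λ j → - (sign (toℕ j) * X j))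
      ≡⟨ cong₂ _+_ (ℤ.*-identityˡ a) (sumFin-cong (suc n) λ j →
           trans (cong (_* X j) (sign-suc (toℕ j))) (sym (ℤ.neg-distribˡ-* (sign (toℕ j)) (X j)))) ⟨
    sumFin (suc (suc n)) (λ j → sign (toℕ j) * F (h j) (tabulate (h ∘ punchIn j))) ∎
    where
    open ≡-Reasoning
    a = F (h zero) (tabulate (h ∘ suc))
    X : Fin (suc n) → ℤ
    X j = F (h (suc j)) (tabulate (h ∘ punchIn (suc j)))

  det≡minor : ∀ n M (f g : Fin n → A) → det n (λ a b → M (f a) (g b)) ≡ minor M (tabulate f) (tabulate g)
  det≡minor zero    M f g = refl
  det≡minor (suc n) M f g = begin
    sumFin (suc n) (λ j → sign (toℕ j) * (M (f zero) (g j) * det n (λ a b → M (f (suc a)) (g (punchIn j b)))))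
      ≡⟨ sumFin-cong (suc n) (λ j → cong (λ t → sign (toℕ j) * (M (f zero) (g j) * t))
           (det≡minor n M (f ∘ suc) (g ∘ punchIn j))) ⟩
    sumFin (suc n) (λ j → sign (toℕ j) * (M (f zero) (g j) * minor M (tabulate (f ∘ suc)) (tabulate (g ∘ punchIn j))))
      ≡⟨ expand-tabulate n (λ c cs → M (f zero) c * minor M (tabulate (f ∘ suc)) cs) g ⟨
    expand (λ c cs → M (f zero) c * minor M (tabulate (f ∘ suc)) cs) (tabulate g)
      ≡⟨ minor-∷ M (f zero) (tabulate (f ∘ suc)) (tabulate g) ⟨
    minor M (tabulate f) (tabulate g) ∎
    where open ≡-Reasoning

-- Determinants of subtournaments and the classes 𝒟ₖ

allSubsets? : ∀ {n ℓ} {P : Pred (Subset n) ℓ} → Decidable P → Dec (∀ s → P s)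
allSubsets? P? = map′ (λ ∄¬P s → decidable-stable (P? s) (∄¬P ∘ (s ,_)))
                      (λ ∀P (s , ¬Ps) → ¬Ps (∀P s))
                      (¬? (anySubset? (¬? ∘ P?)))

members : ∀ {n} → Subset n → List (Fin n)
members s = filter (T? ∘ lookup s) (allFin _)

image : ∀ {m n} → (Fin m → Fin n) → Subset n
image f = Vec.tabulate (λ x → ⌊ Any.any? (x ≟_) (tabulate f) ⌋)

tabulate↭members-image : ∀ {m n} {f : Fin m → Fin n} → Injective _≡_ _≡_ f → tabulate f ↭ members (image f)
tabulate↭members-image {n = n} {f} f-inj = ∼bag⇒↭ (unique∧set⇒bag
  (Unique.tabulate⁺ f-inj) (Unique.filter⁺ (T? ∘ lookup (image f)) (Unique.allFin⁺ n)) (mk⇔ to from))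
  where
  lookup-image : ∀ x → lookup (image f) x ≡ ⌊ Any.any? (x ≟_) (tabulate f) ⌋
  lookup-image = lookup∘tabulate _
  to : ∀ {x} → x ∈ tabulate f → x ∈ members (image f)
  to {x} x∈f = ∈-filter⁺ (T? ∘ lookup (image f)) (∈-allFin x)
    (subst T (sym (lookup-image x)) (fromWitness {a? = Any.any? (x ≟_) (tabulate f)} x∈f))
  from : ∀ {x} → x ∈ members (image f) → x ∈ tabulate f
  from {x} x∈s = toWitness {a? = Any.any? (x ≟_) (tabulate f)}
    (subst T (lookup-image x) (proj₂ (∈-filter⁻ (T? ∘ lookup (image f)) {xs = allFin n} x∈s)))

minors≤⇒InD : ∀ k {n} (T : Tournament n) →
  (∀ s → minor (skew T) (members s) (members s) ℤ.≤ + (k ℕ.* k)) → InD k T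
minors≤⇒InD k T minors≤ m f f-inj _ = begin
  detSub T f                                             ≡⟨ det≡minor m (skew T) f f ⟩
  minor (skew T) (tabulate f) (tabulate f)               ≡⟨ minor-↭ (skew T) (tabulate↭members-image f-inj) ⟩
  minor (skew T) (members (image f)) (members (image f)) ≤⟨ minors≤ (image f) ⟩
  + (k ℕ.* k)                                            ∎
  where open ℤ.≤-Reasoning

minor>⇒¬InD : ∀ k {m n} (T : Tournament n) (f : Fin (suc m) → Fin n) → Injective _≡_ _≡_ f →
  + (k ℕ.* k) ℤ.< minor (skew T) (tabulate f) (tabulate f) → ¬ InD k T
minor>⇒¬InD k T f f-inj k²<minor D =
  ℤ.<⇒≱ k²<minor (subst (ℤ._≤ + (k ℕ.* k)) (det≡minor _ (skew T) f f) (D _ f f-inj (s≤s z≤n)))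

-- Embeddings of tournaments

injective⇒surjective : ∀ {n} {f : Fin n → Fin n} → Injective _≡_ _≡_ f → ∀ y → ∃ λ x → f x ≡ y
injective⇒surjective {suc n} {f} f-inj y with any? (λ x → f x ≟ y)
... | yes hit  = hit
... | no  miss = ⊥-elim (ℕ.<-irrefl refl (injective⇒≤ {f = f′} f′-inj))
  where
  f′ : Fin (suc n) → Fin n
  f′ x = punchOut {i = y} {j = f x} (miss ∘ (x ,_) ∘ sym)
  f′-inj : Injective _≡_ _≡_ f′
  f′-inj {a} {b} = f-inj ∘ punchOut-injective (miss ∘ (a ,_) ∘ sym) (miss ∘ (b ,_) ∘ sym)

record Embedding {m n} (S : Tournament m) (T : Tournament n) : Set where
  field
    map       : Fin m → Fin n
    injective : Injective _≡_ _≡_ map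
    arc-map   : ∀ a b → arc T (map a) (map b) ≡ arc S a b

  skew-map : ∀ a b → skew T (map a) (map b) ≡ skew S a b
  skew-map a b rewrite arc-map a b | arc-map b a = refl

open Embedding

InD-embedding : ∀ {k m n} {S : Tournament m} {T : Tournament n} → Embedding S T → InD k T → InD k S
InD-embedding e D j f f-inj 1≤j =
  subst (ℤ._≤ _) (det-cong j (λ a b → skew-map e (f a) (f b))) (D j (map e ∘ f) (f-inj ∘ injective e) 1≤j)

CoOrRevertices : ∀ {n} → Tournament n → Fin n → Fin n → Set
CoOrRevertices T a b = Covertices T a b ⊎ Revertices T a b

coOrRevertices? : ∀ {n} (T : Tournament n) a b → Dec (CoOrRevertices T a b)
coOrRevertices? T a b = twins? (λ v → arc T b v) ⊎-dec twins? (λ v → arc T v b)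
  where
  twins? : ∀ (g : Fin _ → Bool) → Dec (a ≢ b × (∀ v → v ≢ a → v ≢ b → arc T a v ≡ g v))
  twins? g = ¬? (a ≟ b) ×-dec all? λ v → ¬? (v ≟ a) →-dec ¬? (v ≟ b) →-dec arc T a v Bool.≟ g v

reflect-coOrRevertices : ∀ {m n} {S : Tournament m} {T : Tournament n} (e : Embedding S T) {a b} →
  CoOrRevertices T (map e a) (map e b) → CoOrRevertices S a b
reflect-coOrRevertices {S = S} {T} e {a} {b} =
  ⊎-map (reflect {arc T (map e b)} {arc S b} (arc-map e b))
        (reflect {λ v → arc T v (map e b)} {λ v → arc S v b} (λ v → arc-map e v b))
  where
  reflect : ∀ {g h} → (∀ v → g (map e v) ≡ h v) →
    map e a ≢ map e b × (∀ v → v ≢ map e a → v ≢ map e b → arc T (map e a) v ≡ g v) →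
    a ≢ b × (∀ v → v ≢ a → v ≢ b → arc S a v ≡ h v)
  reflect g∘e≗h (ea≢eb , twin) = ea≢eb ∘ cong (map e) , λ v v≢a v≢b →
    trans (sym (arc-map e a v)) (trans (twin (map e v) (v≢a ∘ injective e) (v≢b ∘ injective e)) (g∘e≗h v))

module _ {n} {S T : Tournament n} (e : Embedding S T) where

  private
    surj = injective⇒surjective (injective e)

  inverse : Embedding T S
  inverse = record
    { map       = proj₁ ∘ surj
    ; injective = λ {x} {y} eq → trans (sym (proj₂ (surj x))) (trans (cong (map e) eq) (proj₂ (surj y)))
    ; arc-map   = λ a b → trans (sym (arc-map e _ _)) (cong₂ (arc T) (proj₂ (surj a)) (proj₂ (surj b)))
    }

  inverse-map : ∀ a → map inverse (map e a) ≡ a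
  inverse-map a = injective e (proj₂ (surj (map e a)))

  transport-coOrRevertices : ∀ {a b} → CoOrRevertices S a b → CoOrRevertices T (map e a) (map e b)
  transport-coOrRevertices {a} {b} =
    reflect-coOrRevertices inverse ∘ subst₂ (CoOrRevertices S) (sym (inverse-map a)) (sym (inverse-map b))

extend : ∀ {n} → Tournament n → (Fin n → Bool) → Tournament (suc n)
extend {n} S N = record { arc = arc⁺ ; irrefl = irrefl⁺ ; oneArc = oneArc⁺ }
  where
  arc⁺ : Fin (suc n) → Fin (suc n) → Bool
  arc⁺ zero    zero    = false
  arc⁺ zero    (suc j) = N j
  arc⁺ (suc i) zero    = not (N i)
  arc⁺ (suc i) (suc j) = arc S i j

  irrefl⁺ : ∀ i → arc⁺ i i ≡ false
  irrefl⁺ zero    = refl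
  irrefl⁺ (suc i) = irrefl S i

  oneArc⁺ : ∀ i j → i ≢ j → arc⁺ j i ≡ not (arc⁺ i j)
  oneArc⁺ zero    zero    0≢0 = ⊥-elim (0≢0 refl)
  oneArc⁺ zero    (suc j) _   = refl
  oneArc⁺ (suc i) zero    _   = sym (not-involutive (N i))
  oneArc⁺ (suc i) (suc j) i≢j = oneArc S i j (i≢j ∘ cong suc)

extend-embedding : ∀ {m n} {S : Tournament m} {T : Tournament n} (e : Embedding S T) v →
  (∀ k → map e k ≢ v) → (N : Fin m → Bool) → (∀ k → N k ≡ arc T v (map e k)) → Embedding (extend S N) T
extend-embedding {S = S} {T} e v v∉e N N≗arc = record { map = map⁺ ; injective = inj⁺ ; arc-map = arc-map⁺ }
  where
  map⁺ : Fin _ → Fin _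
  map⁺ zero    = v
  map⁺ (suc k) = map e k

  inj⁺ : Injective _≡_ _≡_ map⁺
  inj⁺ {zero}  {zero}  _  = refl
  inj⁺ {zero}  {suc k} eq = ⊥-elim (v∉e k (sym eq))
  inj⁺ {suc k} {zero}  eq = ⊥-elim (v∉e k eq)
  inj⁺ {suc k} {suc l} eq = cong suc (injective e eq)

  arc-map⁺ : ∀ a b → arc T (map⁺ a) (map⁺ b) ≡ arc (extend S N) a b
  arc-map⁺ zero    zero    = irrefl T v
  arc-map⁺ zero    (suc l) = sym (N≗arc l)
  arc-map⁺ (suc k) zero    = trans (oneArc T v (map e k) (v∉e k ∘ sym)) (cong not (sym (N≗arc k)))
  arc-map⁺ (suc k) (suc l) = arc-map e k l

-- L₆ and its one-vertex extensions

_<ᵇ_ : ∀ {n} → Fin n → Fin n → Bool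
zero  <ᵇ suc _ = true
_     <ᵇ zero  = false
suc i <ᵇ suc j = i <ᵇ j

-- L6arc by pattern matching, which evaluates much faster in the exhaustive check below.
l6 : Fin 6 → Fin 6 → Bool
l6 5F 0F = true
l6 5F 2F = true
l6 5F 4F = true
l6 5F _  = false
l6 1F 5F = true
l6 3F 5F = true
l6 _  5F = false
l6 i  j  = i <ᵇ j

L6 : Tournament 6
L6 = record
  { arc    = l6
  ; irrefl = toWitness {a? = all? λ i → l6 i i Bool.≟ false} _
  ; oneArc = toWitness {a? = all? λ i → all? λ j → ¬? (i ≟ j) →-dec l6 j i Bool.≟ not (l6 i j)} _
  }

L6-arc : ∀ i j → arc L6 i j ≡ L6arc i j
L6-arc = toWitness {a? = all? λ i → all? λ j → l6 i j Bool.≟ L6arc i j} _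

¬InD3-L6 : ¬ InD 3 L6
¬InD3-L6 = minor>⇒¬InD 3 L6 (λ i → i) (λ eq → eq)
  (toWitness {a? = + 9 ℤ.<? minor (skew L6) (allFin 6) (allFin 6)} _)

L6⁺ : Subset 6 → Tournament 7
L6⁺ N = extend L6 (lookup N)

HasTwin : Subset 6 → Set
HasTwin N = ∃[ k ] CoOrRevertices (L6⁺ N) zero (suc k)

hasTwin? : ∀ N → Dec (HasTwin N)
hasTwin? N = any? λ k → coOrRevertices? (L6⁺ N) zero (suc k)

-- Opaque, as unfolding this exhaustive check at a symbolic N would be hopelessly expensive.
opaque
  L6⁺-dichotomy : ∀ N →
      HasTwin N × (∀ s → minor (skew (L6⁺ N)) (members s) (members s) ℤ.≤ + 25)
    ⊎ ¬ HasTwin N × ∃[ x ] + 25 ℤ.< minor (skew (L6⁺ N)) (tabulate (punchIn x)) (tabulate (punchIn x))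
  L6⁺-dichotomy = toWitness {a? = allSubsets? λ N →
      hasTwin? N ×-dec allSubsets? (λ s → minor (skew (L6⁺ N)) (members s) (members s) ℤ.≤? + 25)
    ⊎-dec ¬? (hasTwin? N) ×-dec any? (λ x →
            + 25 ℤ.<? minor (skew (L6⁺ N)) (tabulate (punchIn x)) (tabulate (punchIn x)))} _

L6⁺-criterion : ∀ N → InD 5 (L6⁺ N) ⇔ HasTwin N
L6⁺-criterion N with L6⁺-dichotomy N
... | inj₁ (twin , minors≤)       = mk⇔ (const twin) (const (minors≤⇒InD 5 (L6⁺ N) minors≤))
... | inj₂ (¬twin , x , 25<minor) =
  mk⇔ (⊥-elim ∘ minor>⇒¬InD 5 (L6⁺ N) (punchIn x) (punchIn-injective x _ _) 25<minor) (⊥-elim ∘ ¬twin)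

proposition3p7 : (T : Tournament 7) → FirstSixIsoL6 T →
    ((InD 5 T × ¬ InD 3 T) ⇔
     (∃[ i ] (Covertices T (fromℕ 6) (inject₁ i) ⊎ Revertices T (fromℕ 6) (inject₁ i))))
proposition3p7 T (σ , σ-inj , σ-iso) = mk⇔
  (λ (D₅ , _) → twin-in-T (Equivalence.to (L6⁺-criterion N) (InD-embedding {k = 5} e D₅)))
  (λ twin → InD-embedding {k = 5} (inverse e) (Equivalence.from (L6⁺-criterion N) (twin-in-L6⁺ twin))
          , ¬InD3-L6 ∘ InD-embedding {k = 3} L6↪T)
  where
  L6↪T : Embedding L6 T
  L6↪T = record
    { map       = inject₁ ∘ σ
    ; injective = σ-inj ∘ inject₁-injective
    ; arc-map   = λ a b → trans (σ-iso a b) (sym (L6-arc a b))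
    }

  N : Subset 6
  N = Vec.tabulate (λ k → arc T (fromℕ 6) (inject₁ (σ k)))

  e : Embedding (L6⁺ N) T
  e = extend-embedding L6↪T (fromℕ 6) (λ k → fromℕ≢inject₁ ∘ sym) (lookup N) (lookup∘tabulate _)

  twin-in-T : HasTwin N → ∃[ i ] CoOrRevertices T (fromℕ 6) (inject₁ i)
  twin-in-T (k , twin) = σ k , transport-coOrRevertices e twin

  twin-in-L6⁺ : ∃[ i ] CoOrRevertices T (fromℕ 6) (inject₁ i) → HasTwin N
  twin-in-L6⁺ (i , twin) with injective⇒surjective σ-inj i
  ... | k , refl = k , reflect-coOrRevertices e twin
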